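{- Let $G$ be a connected graph and $L$ a list assignment for $G$. If there exists an ordering $\sigma$ of $V(G)$ such that each vertex $v$ is preceded in $\sigma$ by fewer than $|L(v)|$ of its neighbors, then $G$ is $L$-swappable. In particular, this holds if $|L(v)|\ge d(v)$ for all $v\in V(G)$ and there exists some vertex $w$ with $|L(w)|>d(w)$.
   Context: A list assignment $L$ assigns to each vertex $v$ a set $L(v)$ of colors. An $L$-coloring is a proper coloring $\varphi$ with $\varphi(v)\in L(v)$ for all $v$. An $\alpha,\beta$-Kempe swap interchanges colors $\alpha,\beta$ on one connected component of the subgraph induced by vertices colored $\alpha$ or $\beta$; it is $L$-valid for $\varphi$ if the result is again an $L$-coloring. $G$ is $L$-swappable if every two of its $L$-colorings can be transformed into each other by a sequence of $L$-valid Kempe swaps. -}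

module Defs where

open import Data.Nat using (ℕ; zero; suc; _<_; _≤_)
open import Data.Bool using (Bool; true; false; if_then_else_; _∧_)
open import Data.Fin using (Fin) renaming (_<_ to _<ᶠ_)
open import Data.Fin.Subset using (Subset; _∈_; ∣_∣)
open import Data.Fin.Permutation using (Permutation′; _⟨$⟩ʳ_)
open import Data.List using (List; []; _∷_; allFin)
open import Data.Product using (Σ; ∃; _×_; _,_)
open import Data.Sum using (_⊎_)
open import Relation.Nullary using (¬_; Dec; yes; no)
open import Relation.Nullary.Decidable using (⌊_⌋)
open import Relation.Binary.PropositionalEquality using (_≡_; _≢_)
open import Relation.Binary.Construct.Closure.ReflexiveTransitive using (Star)
import Data.Fin as F

record Graph (n : ℕ) : Set where
  field
    adj   : Fin n → Fin n → Bool
    sym   : ∀ u v → adj u v ≡ adj v u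
    irref : ∀ v → adj v v ≡ false
open Graph public

countB : ∀ {A : Set} → (A → Bool) → List A → ℕ
countB p [] = 0
countB p (x ∷ xs) = if p x then suc (countB p xs) else countB p xs

deg : ∀ {n} → Graph n → Fin n → ℕ
deg G v = countB (λ u → adj G v u) (allFin _)

data Reach {n} (G : Graph n) (u : Fin n) : Fin n → Set where
  here : Reach G u u
  step : ∀ {v w} → Reach G u v → adj G v w ≡ true → Reach G u w

Connected : ∀ {n} → Graph n → Set
Connected G = ∀ u v → Reach G u v

ListAssignment : ℕ → ℕ → Set
ListAssignment n k = Fin n → Subset k

IsLColoring : ∀ {n k} → Graph n → ListAssignment n k → (Fin n → Fin k) → Set
IsLColoring G L φ =
  (∀ v → φ v ∈ L v) × (∀ u v → adj G u v ≡ true → φ u ≢ φ v)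

-- number of neighbours of v preceding v in the ordering σ
-- (σ maps a vertex to its position)
precedingNbrs : ∀ {n} → Graph n → Permutation′ n → Fin n → ℕ
precedingNbrs G σ v =
  countB (λ u → adj G v u ∧ ⌊ (σ ⟨$⟩ʳ u) F.<? (σ ⟨$⟩ʳ v) ⌋) (allFin _)

data KComp {n k} (G : Graph n) (φ : Fin n → Fin k) (α β : Fin k) (x : Fin n)
     : Fin n → Set where
  base : (φ x ≡ α ⊎ φ x ≡ β) → KComp G φ α β x x
  step : ∀ {v w} → KComp G φ α β x v → adj G v w ≡ true →
         (φ w ≡ α ⊎ φ w ≡ β) → KComp G φ α β x w

swapCol : ∀ {k} → Fin k → Fin k → Fin k → Fin k
swapCol α β c with c F.≟ α
... | yes _ = β
... | no _ with c F.≟ β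
...   | yes _ = α
...   | no _ = c

KempeSwap : ∀ {n k} → Graph n → (Fin n → Fin k) → (Fin n → Fin k) → Set
KempeSwap {n} {k} G φ ψ =
  Σ (Fin k) λ α → Σ (Fin k) λ β → Σ (Fin n) λ x →
    (φ x ≡ α ⊎ φ x ≡ β) ×
    (∀ v → KComp G φ α β x v → ψ v ≡ swapCol α β (φ v)) ×
    (∀ v → ¬ KComp G φ α β x v → ψ v ≡ φ v)

LSwapStep : ∀ {n k} → Graph n → ListAssignment n k →
            (Fin n → Fin k) → (Fin n → Fin k) → Set
LSwapStep G L φ ψ = IsLColoring G L φ × IsLColoring G L ψ × KempeSwap G φ ψ

-- G is L-swappable (final colouring reached up to pointwise equality)
LSwappable : ∀ {n k} → Graph n → ListAssignment n k → Set
LSwappable {n} {k} G L =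
  ∀ φ ψ → IsLColoring G L φ → IsLColoring G L ψ →
  Σ (Fin n → Fin k) λ χ → Star (LSwapStep G L) φ χ × (∀ v → χ v ≡ ψ v)

-- A Kempe swap of G with v isolated lifts to G when v has fewer than |L(v)| neighbours. If
-- the colour of v is not in the swapped pair, or v can first be recoloured to a colour of L(v)
-- outside the pair unused on its neighbours, the component in G is the old one. Otherwise L(v)
-- is covered by the colour a of v, its partner b in the pair and the colours on N(v), so
-- |L(v)| > d(v) forces b ∈ L(v) and b on at most one neighbour; if that neighbour is swapped,
-- v joins the component and changes from a to b. Thus isolating a vertex with fewer than
-- |L(v)| remaining neighbours reflects L-swappability, and isolating the vertices one at a time
-- (in reverse order of σ; resp. first w, then always a vertex adjacent to an isolated one, which
-- connectivity provides) reaches the edgeless graph, where recolouring one vertex at a time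
-- connects any two L-colourings.

module Submission where

open import Defs renaming (sym to adj-sym)
open import Data.Nat using (ℕ; zero; suc; _<_; _≤_; z≤n; s≤s; s≤s⁻¹; _≤?_)
open import Data.Nat.Properties using (<⇒≱; ≤-refl; ≤-trans; ≤-reflexive; m≤n⇒m≤1+n; <-≤-trans; ≤-<-trans; <-irrefl; <⇒≤; ≮⇒≥; ≤∧≢⇒<; n<1+n)
open import Data.Bool using (Bool; true; false; not; _∧_; _∨_; if_then_else_)
open import Data.Bool.Properties using (T-≡; ¬-not; ∨-zeroʳ) renaming (_≟_ to _≟ᵇ_)
open import Data.Fin using (Fin; zero; suc; _≟_; toℕ; fromℕ<) renaming (_<?_ to _<ᶠ?_)
open import Data.Fin.Subset using (Subset; _∈_; ∣_∣; inside; outside)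
open import Data.Fin.Subset.Properties using (_∈?_)
open import Data.Fin.Properties using (toℕ<n; any?; all?; toℕ-injective; toℕ-fromℕ<)
open import Data.Fin.Permutation using (Permutation′; _⟨$⟩ʳ_; _⟨$⟩ˡ_; inverseʳ)
open import Function.Bundles using (Injection)
open import Function.Properties.Inverse using (↔⇒↣)
open import Data.List using (List; []; _∷_; length; map; filterᵇ; allFin)
open import Data.List.Properties using (length-map)
open import Data.List.Membership.Propositional using () renaming (_∈_ to _∈ₗ_)
open import Data.List.Membership.Propositional.Properties using (∈-allFin; ∈-map⁺; ∈-filter⁺)
open import Data.List.Relation.Unary.Any using (here; there)
open import Data.Vec using ([]; _∷_; here; there)
open import Data.Vec.Functional using (updateAt)
open import Data.Vec.Functional.Properties using (updateAt-updates; updateAt-minimal)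
open import Data.Product using (Σ; ∃; ∃₂; _×_; _,_; proj₁; proj₂)
open import Data.Sum using (_⊎_; inj₁; inj₂; map₂)
open import Data.Empty using (⊥-elim)
open import Function using (_∘_; const; Equivalence)
open import Relation.Nullary using (¬_; Dec; does; yes; no; ¬¬-excluded-middle)
open import Relation.Nullary.Negation using (contradiction)
open import Relation.Nullary.Decidable using (⌊_⌋; isYes≗does; _⊎-dec_; _×-dec_; _→-dec_; ¬?; decidable-stable; dec-true; dec-false)
open import Relation.Binary.PropositionalEquality
open import Relation.Binary.Construct.Closure.ReflexiveTransitive as Star using (Star; ε; _◅_; _◅◅_)

countB-mono : ∀ {A : Set} {p q : A → Bool} → (∀ x → q x ≡ true → p x ≡ true) →
              ∀ xs → countB q xs ≤ countB p xs
countB-mono q⇒p [] = z≤n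
countB-mono {p = p} {q} q⇒p (x ∷ xs) with q x in qx | p x in px
... | true  | true  = s≤s (countB-mono q⇒p xs)
... | true  | false = contradiction (trans (sym (q⇒p x qx)) px) λ ()
... | false | true  = m≤n⇒m≤1+n (countB-mono q⇒p xs)
... | false | false = countB-mono q⇒p xs

countB-< : ∀ {A : Set} {p q : A → Bool} → (∀ x → q x ≡ true → p x ≡ true) →
           ∀ {w xs} → w ∈ₗ xs → p w ≡ true → q w ≡ false → countB q xs < countB p xs
countB-< q⇒p {xs = x ∷ xs} (here refl) pw qw rewrite pw | qw = s≤s (countB-mono q⇒p xs)
countB-< {p = p} {q} q⇒p {xs = x ∷ xs} (there w∈xs) pw qw with q x in qx | p x in px
... | true  | true  = s≤s (countB-< q⇒p w∈xs pw qw)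
... | true  | false = contradiction (trans (sym (q⇒p x qx)) px) λ ()
... | false | true  = m≤n⇒m≤1+n (countB-< q⇒p w∈xs pw qw)
... | false | false = countB-< q⇒p w∈xs pw qw

length-filterᵇ : ∀ {A : Set} (p : A → Bool) xs → length (filterᵇ p xs) ≡ countB p xs
length-filterᵇ p [] = refl
length-filterᵇ p (x ∷ xs) with p x
... | true  = cong suc (length-filterᵇ p xs)
... | false = length-filterᵇ p xs

unsucs : ∀ {k} → List (Fin (suc k)) → List (Fin k)
unsucs []           = []
unsucs (zero  ∷ cs) = unsucs cs
unsucs (suc c ∷ cs) = c ∷ unsucs cs

suc∈⇒∈unsucs : ∀ {k} {c : Fin k} cs → suc c ∈ₗ cs → c ∈ₗ unsucs cs
suc∈⇒∈unsucs (zero  ∷ cs) (there c∈cs) = suc∈⇒∈unsucs cs c∈cs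
suc∈⇒∈unsucs (suc c ∷ cs) (here refl)  = here refl
suc∈⇒∈unsucs (suc c ∷ cs) (there c∈cs) = there (suc∈⇒∈unsucs cs c∈cs)

length-unsucs : ∀ {k} (cs : List (Fin (suc k))) → length (unsucs cs) ≤ length cs
length-unsucs []           = z≤n
length-unsucs (zero  ∷ cs) = m≤n⇒m≤1+n (length-unsucs cs)
length-unsucs (suc c ∷ cs) = s≤s (length-unsucs cs)

zero∈⇒length-unsucs< : ∀ {k} (cs : List (Fin (suc k))) → zero ∈ₗ cs → length (unsucs cs) < length cs
zero∈⇒length-unsucs< (zero  ∷ cs) _            = s≤s (length-unsucs cs)
zero∈⇒length-unsucs< (suc c ∷ cs) (there 0∈cs) = s≤s (zero∈⇒length-unsucs< cs 0∈cs)

∣S∣≤length : ∀ {k} (S : Subset k) cs → (∀ {c} → c ∈ S → c ∈ₗ cs) → ∣ S ∣ ≤ length cs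
∣S∣≤length []            cs S⊆cs = z≤n
∣S∣≤length (outside ∷ S) cs S⊆cs =
  ≤-trans (∣S∣≤length S (unsucs cs) (λ c∈S → suc∈⇒∈unsucs cs (S⊆cs (there c∈S))))
          (length-unsucs cs)
∣S∣≤length (inside ∷ S)  cs S⊆cs =
  ≤-trans (s≤s (∣S∣≤length S (unsucs cs) (λ c∈S → suc∈⇒∈unsucs cs (S⊆cs (there c∈S)))))
          (zero∈⇒length-unsucs< cs (S⊆cs here))

neighbours : ∀ {n} → Graph n → Fin n → List (Fin n)
neighbours H v = filterᵇ (adj H v) (allFin _)

∣L∣≤deg : ∀ {n k} (H : Graph n) (L : ListAssignment n k) (v : Fin n) (f : Fin n → Fin k) →
          (∀ {c} → c ∈ L v → ∃ λ w → adj H v w ≡ true × f w ≡ c) → ∣ L v ∣ ≤ deg H v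
∣L∣≤deg H L v f covered = ≤-trans (∣S∣≤length (L v) (map f (neighbours H v)) on-neighbour) length≤deg
  where
  on-neighbour : ∀ {c} → c ∈ L v → c ∈ₗ map f (neighbours H v)
  on-neighbour c∈L with covered c∈L
  ... | w , vw , refl = ∈-map⁺ f (∈-filter⁺ _ (∈-allFin w) (Equivalence.from T-≡ vw))
  length≤deg : length (map f (neighbours H v)) ≤ deg H v
  length≤deg rewrite length-map f (neighbours H v) | length-filterᵇ (adj H v) (allFin _) = ≤-refl

InPair : ∀ {k} → Fin k → Fin k → Fin k → Set
InPair α β c = c ≡ α ⊎ c ≡ β

InPair? : ∀ {k} (α β c : Fin k) → Dec (InPair α β c)
InPair? α β c = (c ≟ α) ⊎-dec (c ≟ β)

swapCol-α : ∀ {k} (α β : Fin k) → swapCol α β α ≡ β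
swapCol-α α β with α ≟ α
... | yes _   = refl
... | no α≢α = contradiction refl α≢α

swapCol-β : ∀ {k} (α β : Fin k) → swapCol α β β ≡ α
swapCol-β α β with β ≟ α
... | yes β≡α = β≡α
... | no _ with β ≟ β
...   | yes _   = refl
...   | no β≢β = contradiction refl β≢β

swapCol-other : ∀ {k} {α β c : Fin k} → c ≢ α → c ≢ β → swapCol α β c ≡ c
swapCol-other {α = α} {β} {c} c≢α c≢β with c ≟ α
... | yes c≡α = contradiction c≡α c≢α
... | no _ with c ≟ β
...   | yes c≡β = contradiction c≡β c≢β
...   | no _    = refl

swapCol-diag : ∀ {k} (α c : Fin k) → swapCol α α c ≡ c
swapCol-diag α c = by-cases (c ≟ α)
  where
  by-cases : Dec (c ≡ α) → swapCol α α c ≡ c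
  by-cases (yes refl) = swapCol-α c c
  by-cases (no c≢α)   = swapCol-other c≢α c≢α

swapCol-involutive : ∀ {k} (α β c : Fin k) → swapCol α β (swapCol α β c) ≡ c
swapCol-involutive α β c = by-cases (c ≟ α) (c ≟ β)
  where
  by-cases : Dec (c ≡ α) → Dec (c ≡ β) → swapCol α β (swapCol α β c) ≡ c
  by-cases (yes refl) _ = trans (cong (swapCol c β) (swapCol-α c β)) (swapCol-β c β)
  by-cases (no _) (yes refl) = trans (cong (swapCol α c) (swapCol-β α c)) (swapCol-α α c)
  by-cases (no c≢α) (no c≢β) =
    trans (cong (swapCol α β) (swapCol-other c≢α c≢β)) (swapCol-other c≢α c≢β)

swapCol-moves : ∀ {k} {α β c : Fin k} → α ≢ β → InPair α β c → swapCol α β c ≢ c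
swapCol-moves {α = α} {β} α≢β (inj₁ refl) swap≡α = α≢β (sym (trans (sym (swapCol-α α β)) swap≡α))
swapCol-moves {α = α} {β} α≢β (inj₂ refl) swap≡β = α≢β (trans (sym (swapCol-β α β)) swap≡β)

swapCol-injective : ∀ {k} (α β : Fin k) {c d} → swapCol α β c ≡ swapCol α β d → c ≡ d
swapCol-injective α β {c} {d} eq =
  trans (sym (swapCol-involutive α β c)) (trans (cong (swapCol α β) eq) (swapCol-involutive α β d))

swapCol-InPair : ∀ {k} {α β c : Fin k} → InPair α β c → InPair α β (swapCol α β c)
swapCol-InPair {α = α} {β} (inj₁ refl) = inj₂ (swapCol-α α β)
swapCol-InPair {α = α} {β} (inj₂ refl) = inj₁ (swapCol-β α β)

InPair-partner : ∀ {k} {α β a c : Fin k} → InPair α β a → InPair α β c → c ≡ a ⊎ c ≡ swapCol α β a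
InPair-partner {α = α} {β} (inj₁ refl) (inj₁ refl) = inj₁ refl
InPair-partner {α = α} {β} (inj₁ refl) (inj₂ refl) = inj₂ (sym (swapCol-α α β))
InPair-partner {α = α} {β} (inj₂ refl) (inj₁ refl) = inj₂ (sym (swapCol-β α β))
InPair-partner {α = α} {β} (inj₂ refl) (inj₂ refl) = inj₁ refl

Proper : ∀ {n k} → Graph n → (Fin n → Fin k) → Set
Proper G φ = ∀ u v → adj G u v ≡ true → φ u ≢ φ v

adj⇒≢ : ∀ {n} (G : Graph n) {u w} → adj G u w ≡ true → u ≢ w
adj⇒≢ G {u} uw refl with () ← trans (sym uw) (irref G u)

KComp-InPair : ∀ {n k} {G : Graph n} {φ : Fin n → Fin k} {α β x u} →
               KComp G φ α β x u → InPair α β (φ u)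
KComp-InPair (base c)     = c
KComp-InPair (step _ _ c) = c

kempe-proper : ∀ {n k} {G : Graph n} {φ ψ : Fin n → Fin k} → KempeSwap G φ ψ → Proper G φ → Proper G ψ
kempe-proper {G = G} {φ} {ψ} (α , β , x , _ , on-K , off-K) φ-proper u w uw ψu≡ψw =
  ¬¬-excluded-middle λ
    { (yes u∈K) → ¬¬-excluded-middle λ
        { (yes w∈K) → φ-proper u w uw
            (swapCol-injective α β (trans (sym (on-K u u∈K)) (trans ψu≡ψw (on-K w w∈K))))
        ; (no w∉K) → w∉K (drags-in u∈K uw ψu≡ψw w∉K) }
    ; (no u∉K) → ¬¬-excluded-middle λ
        { (yes w∈K) → u∉K (drags-in w∈K (trans (adj-sym G w u) uw) (sym ψu≡ψw) u∉K)
        ; (no w∉K) → φ-proper u w uw (trans (sym (off-K u u∉K)) (trans ψu≡ψw (off-K w w∉K))) } }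
  where
  drags-in : ∀ {a b} → KComp G φ α β x a → adj G a b ≡ true → ψ a ≡ ψ b →
             ¬ KComp G φ α β x b → KComp G φ α β x b
  drags-in {a} {b} a∈K ab ψa≡ψb b∉K =
    step a∈K ab (subst (InPair α β) (trans (sym (on-K a a∈K)) (trans ψa≡ψb (off-K b b∉K)))
                       (swapCol-InPair (KComp-InPair a∈K)))

_[_≔_] : ∀ {n k} → (Fin n → Fin k) → Fin n → Fin k → Fin n → Fin k
θ [ v ≔ c ] = updateAt θ v (const c)

≔-updates : ∀ {n k} (θ : Fin n → Fin k) v c → (θ [ v ≔ c ]) v ≡ c
≔-updates θ v c = updateAt-updates v θ

≔-minimal : ∀ {n k} (θ : Fin n → Fin k) {v u} c → u ≢ v → (θ [ v ≔ c ]) u ≡ θ u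
≔-minimal θ {v} {u} c u≢v = updateAt-minimal u v θ u≢v

recolour-step : ∀ {n k} {G : Graph n} {L : ListAssignment n k} {θ : Fin n → Fin k} {v c} →
  IsLColoring G L θ → c ∈ L v → (∀ u → adj G v u ≡ true → θ u ≢ c) → LSwapStep G L θ (θ [ v ≔ c ])
recolour-step {G = G} {L} {θ} {v} {c} θ-col@(θ∈L , θ-proper) c∈L c-free =
  θ-col , (ψ∈L , kempe-proper swap θ-proper) , swap
  where
  component-is-v : ∀ {u} → KComp G θ (θ v) c v u → u ≡ v
  component-is-v (base _) = refl
  component-is-v (step {w = w} u∈K vw w-col) with refl ← component-is-v u∈K | w-col
  ... | inj₁ θw≡θv = contradiction (sym θw≡θv) (θ-proper v w vw)
  ... | inj₂ θw≡c  = contradiction θw≡c (c-free w vw)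
  swap : KempeSwap G θ (θ [ v ≔ c ])
  swap = θ v , c , v , inj₁ refl , on-K , off-K
    where
    on-K : ∀ u → KComp G θ (θ v) c v u → (θ [ v ≔ c ]) u ≡ swapCol (θ v) c (θ u)
    on-K u u∈K with refl ← component-is-v u∈K = trans (≔-updates θ v c) (sym (swapCol-α (θ v) c))
    off-K : ∀ u → ¬ KComp G θ (θ v) c v u → (θ [ v ≔ c ]) u ≡ θ u
    off-K u u∉K = ≔-minimal θ c λ { refl → u∉K (base (inj₁ refl)) }
  ψ∈L : ∀ u → (θ [ v ≔ c ]) u ∈ L u
  ψ∈L u with u ≟ v
  ... | yes refl = subst (_∈ L v) (sym (≔-updates θ v c)) c∈L
  ... | no u≢v   = subst (_∈ L u) (sym (≔-minimal θ c u≢v)) (θ∈L u)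

record _⊆ᴳ_ {n} (H₁ H₂ : Graph n) : Set where
  constructor edges⊆
  field edge-⊆ : ∀ {u w} → adj H₁ u w ≡ true → adj H₂ u w ≡ true
open _⊆ᴳ_

LColouring-⊆ : ∀ {n k} {H₁ H₂ : Graph n} {L : ListAssignment n k} {θ} →
               H₁ ⊆ᴳ H₂ → IsLColoring H₂ L θ → IsLColoring H₁ L θ
LColouring-⊆ H₁⊆H₂ (θ∈L , θ-proper) = θ∈L , λ u w uw → θ-proper u w (edge-⊆ H₁⊆H₂ uw)

KComp-⊆ : ∀ {n k} {H₁ H₂ : Graph n} {φ : Fin n → Fin k} {α β x u} →
          H₁ ⊆ᴳ H₂ → KComp H₁ φ α β x u → KComp H₂ φ α β x u
KComp-⊆ H₁⊆H₂ (base c)        = base c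
KComp-⊆ H₁⊆H₂ (step u∈K uw c) = step (KComp-⊆ H₁⊆H₂ u∈K) (edge-⊆ H₁⊆H₂ uw) c

swappable-cong : ∀ {n k} {H₁ H₂ : Graph n} {L : ListAssignment n k} →
                 (∀ u w → adj H₁ u w ≡ adj H₂ u w) → LSwappable H₁ L → LSwappable H₂ L
swappable-cong {H₁ = H₁} {H₂} {L} same swappable φ ψ φ-col ψ-col
  = let χ , steps , χ≗ψ = swappable φ ψ (LColouring-⊆ H₁⊆H₂ φ-col) (LColouring-⊆ H₁⊆H₂ ψ-col)
    in χ , Star.map transport steps , χ≗ψ
  where
  H₁⊆H₂ : H₁ ⊆ᴳ H₂
  H₁⊆H₂ = edges⊆ λ {u} {w} → trans (sym (same u w))
  H₂⊆H₁ : H₂ ⊆ᴳ H₁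
  H₂⊆H₁ = edges⊆ λ {u} {w} → trans (same u w)
  transport : ∀ {θ θ′} → LSwapStep H₁ L θ θ′ → LSwapStep H₂ L θ θ′
  transport (θ-col , θ′-col , α , β , x , x-col , on-K , off-K) =
    LColouring-⊆ H₂⊆H₁ θ-col , LColouring-⊆ H₂⊆H₁ θ′-col , α , β , x , x-col ,
    (λ u u∈K → on-K u (KComp-⊆ H₂⊆H₁ u∈K)) , (λ u u∉K → off-K u (u∉K ∘ KComp-⊆ H₁⊆H₂))

swappable-edgeless : ∀ {n k} {H : Graph n} {L : ListAssignment n k} →
                     (∀ u w → adj H u w ≡ false) → LSwappable H L
swappable-edgeless {n} {k} {H} {L} no-edge φ ψ φ-col ψ-col
  = let χ , steps , _ , χ≗ψ = recolour-all (allFin n) in χ , steps , λ u → χ≗ψ (∈-allFin u)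
  where
  recolour-all : ∀ us → Σ (Fin n → Fin k) λ χ →
    Star (LSwapStep H L) φ χ × IsLColoring H L χ × (∀ {u} → u ∈ₗ us → χ u ≡ ψ u)
  recolour-all [] = φ , ε , φ-col , λ ()
  recolour-all (v ∷ us) with χ , steps , χ-col , χ≗ψ ← recolour-all us =
    χ [ v ≔ ψ v ] , steps ◅◅ (recolour-v ◅ ε) , proj₁ (proj₂ recolour-v) , agrees
    where
    recolour-v : LSwapStep H L χ (χ [ v ≔ ψ v ])
    recolour-v = recolour-step χ-col (proj₁ ψ-col v) λ u vu → contradiction (trans (sym vu) (no-edge v u)) λ ()
    agrees : ∀ {u} → u ∈ₗ v ∷ us → (χ [ v ≔ ψ v ]) u ≡ ψ u
    agrees (here refl) = ≔-updates χ v (ψ v)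
    agrees {u} (there u∈us) with u ≟ v
    ... | yes refl = ≔-updates χ v (ψ v)
    ... | no u≢v   = trans (≔-minimal χ (ψ v) u≢v) (χ≗ψ u∈us)

-- G − R is modelled by deleting the edges at R, so that all graphs share the vertex set Fin n.
isolate : ∀ {n} → Graph n → (Fin n → Bool) → Graph n
isolate G R = record
  { adj   = λ u w → not (R u) ∧ not (R w) ∧ adj G u w
  ; sym   = isolate-sym
  ; irref = isolate-irref }
  where
  isolate-sym : ∀ u w → not (R u) ∧ not (R w) ∧ adj G u w ≡ not (R w) ∧ not (R u) ∧ adj G w u
  isolate-sym u w with R u | R w
  ... | true  | true  = refl
  ... | true  | false = refl
  ... | false | true  = refl
  ... | false | false = adj-sym G u w
  isolate-irref : ∀ v → not (R v) ∧ not (R v) ∧ adj G v v ≡ false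
  isolate-irref v with R v
  ... | true  = refl
  ... | false = irref G v

isolated-adj : ∀ {n} (G : Graph n) R {u} → R u ≡ true → ∀ w → adj (isolate G R) u w ≡ false
isolated-adj G R Ru w rewrite Ru = refl

isolate-adj : ∀ {n} (G : Graph n) R u w →
  adj (isolate G R) u w ≡ true → R u ≡ false × R w ≡ false × adj G u w ≡ true
isolate-adj G R u w uw with R u | R w
... | false | false = refl , refl , uw

swappable-isolate-all : ∀ {n k} (G : Graph n) {L : ListAssignment n k} {R} →
                        (∀ u → R u ≡ true) → LSwappable (isolate G R) L
swappable-isolate-all G {R = R} all-R = swappable-edgeless λ u → isolated-adj G R (all-R u)

swappable-isolate-none : ∀ {n k} (G : Graph n) {L : ListAssignment n k} →
                         LSwappable (isolate G (const false)) L → LSwappable G L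
swappable-isolate-none G = swappable-cong λ _ _ → refl

module Reattach {n k} (H H′ : Graph n) (L : ListAssignment n k) (v : Fin n)
  (v-isolated : ∀ u → adj H′ v u ≡ false)
  (same-off-v : ∀ u w → u ≢ v → w ≢ v → adj H′ u w ≡ adj H u w)
  (few-neighbours : deg H v < ∣ L v ∣) where

  Colouring : Set
  Colouring = Fin n → Fin k

  no-edge-at-v : ∀ {u} → adj H′ v u ≢ true
  no-edge-at-v {u} vu with () ← trans (sym vu) (v-isolated u)

  H′⊆H : H′ ⊆ᴳ H
  H′⊆H = edges⊆ λ {u} {w} → edge u w
    where
    edge : ∀ u w → adj H′ u w ≡ true → adj H u w ≡ true
    edge u w uw with u ≟ v | w ≟ v
    ... | yes refl | _        = contradiction uw no-edge-at-v
    ... | no _     | yes refl = contradiction (trans (adj-sym H′ v u) uw) no-edge-at-v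
    ... | no u≢v   | no w≢v   = trans (sym (same-off-v u w u≢v w≢v)) uw

  _≈ᵥ_ : Colouring → Colouring → Set
  θ′ ≈ᵥ θ = ∀ u → u ≢ v → θ′ u ≡ θ u

  Reachesᵥ : Colouring → Colouring → Set
  Reachesᵥ θ′ θ₂ = Σ Colouring λ χ → Star (LSwapStep H L) θ′ χ × IsLColoring H L χ × χ ≈ᵥ θ₂

  module LiftSwap (θ θ₂ : Colouring) (θ₂∈L : ∀ u → θ₂ u ∈ L u) (α β : Fin k) (x : Fin n)
    (x-col : InPair α β (θ x))
    (on-K′ : ∀ u → KComp H′ θ α β x u → θ₂ u ≡ swapCol α β (θ u))
    (off-K′ : ∀ u → ¬ KComp H′ θ α β x u → θ₂ u ≡ θ u)
    (α≢β : α ≢ β) (x≢v : x ≢ v) where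

    K′ : Fin n → Set
    K′ = KComp H′ θ α β x

    -- Since α ≢ β, the vertices of K′ are exactly the ones whose colour changes; unlike
    -- membership in K′ this is decidable.
    Moved : Fin n → Set
    Moved u = θ₂ u ≢ θ u

    K′-avoids-v : ∀ {u} → K′ u → u ≢ v
    K′-avoids-v (base _)             refl = x≢v refl
    K′-avoids-v (step {v₁} _ v₁v _) refl = no-edge-at-v (trans (adj-sym H′ v v₁) v₁v)

    K′⇒Moved : ∀ {u} → K′ u → Moved u
    K′⇒Moved u∈K′ θ₂u≡θu = swapCol-moves α≢β (KComp-InPair u∈K′) (trans (sym (on-K′ _ u∈K′)) θ₂u≡θu)

    Moved⇒¬¬K′ : ∀ {u} → Moved u → ¬ ¬ K′ u
    Moved⇒¬¬K′ moved u∉K′ = moved (off-K′ _ u∉K′)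

    Moved⇒InPair : ∀ {u} → Moved u → InPair α β (θ u)
    Moved⇒InPair {u} moved =
      decidable-stable (InPair? α β (θ u)) λ ¬pair → Moved⇒¬¬K′ moved (¬pair ∘ KComp-InPair)

    Spare : Colouring → Set
    Spare θ′ = Σ (Fin k) λ c → c ∈ L v × ¬ InPair α β c × (∀ w → adj H v w ≡ true → θ′ w ≢ c)

    Spare? : ∀ θ′ → Dec (Spare θ′)
    Spare? θ′ = any? λ c → (c ∈? L v) ×-dec ¬? (InPair? α β c) ×-dec
                           all? λ w → (adj H v w ≟ᵇ true) →-dec ¬? (θ′ w ≟ c)

    module _ (θ′ : Colouring) (θ′-col : IsLColoring H L θ′) (θ′≈θ : θ′ ≈ᵥ θ) where

      JoinsV : Set
      JoinsV = InPair α β (θ′ v) × ∃ λ w → adj H v w ≡ true × Moved w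

      JoinsV? : Dec JoinsV
      JoinsV? = InPair? α β (θ′ v) ×-dec any? λ w → (adj H v w ≟ᵇ true) ×-dec ¬? (θ₂ w ≟ θ w)

      K′⇒K : ∀ {u} → K′ u → KComp H θ′ α β x u
      K′⇒K (base c) = base (subst (InPair α β) (sym (θ′≈θ x x≢v)) c)
      K′⇒K (step u∈K′ uw c) =
        step (K′⇒K u∈K′) (edge-⊆ H′⊆H uw)
             (subst (InPair α β) (sym (θ′≈θ _ (K′-avoids-v (step u∈K′ uw c)))) c)

      v∉K⇒¬JoinsV : ¬ KComp H θ′ α β x v → ¬ JoinsV
      v∉K⇒¬JoinsV v∉K (c , w , vw , moved) =
        Moved⇒¬¬K′ moved λ w∈K′ → v∉K (step (K′⇒K w∈K′) (trans (adj-sym H w v) vw) c)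

      new-colour : Fin k
      new-colour = if does JoinsV? then swapCol α β (θ′ v) else θ′ v

      ψ : Colouring
      ψ = θ₂ [ v ≔ new-colour ]

      module _ (joins⇒neighbours-moved : JoinsV → ∀ w → adj H v w ≡ true → InPair α β (θ′ w) → Moved w)
               (joins⇒swap∈L : JoinsV → swapCol α β (θ′ v) ∈ L v) where

        K⊆K′∪v : ∀ {u} → KComp H θ′ α β x u → (u ≡ v × JoinsV) ⊎ (u ≢ v × ¬ ¬ K′ u)
        K⊆K′∪v (base c) = inj₂ (x≢v , λ x∉K′ → x∉K′ (base (subst (InPair α β) (θ′≈θ x x≢v) c)))
        K⊆K′∪v (step {v₁} {w} v₁∈K v₁w c) with K⊆K′∪v v₁∈K
        ... | inj₁ (refl , joins) =
          inj₂ (≢-sym (adj⇒≢ H v₁w) , Moved⇒¬¬K′ (joins⇒neighbours-moved joins w v₁w c))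
        ... | inj₂ (v₁≢v , ¬¬v₁∈K′) with w ≟ v
        ...   | yes refl =
          inj₁ (refl , c , v₁ , trans (adj-sym H v v₁) v₁w , λ θ₂v₁≡θv₁ → ¬¬v₁∈K′ λ v₁∈K′ → K′⇒Moved v₁∈K′ θ₂v₁≡θv₁)
        ...   | no w≢v =
          inj₂ (w≢v , λ w∉K′ → ¬¬v₁∈K′ λ v₁∈K′ →
            w∉K′ (step v₁∈K′ (trans (same-off-v v₁ w v₁≢v w≢v) v₁w) (subst (InPair α β) (θ′≈θ w w≢v) c)))

        ψ-on-K : ∀ u → KComp H θ′ α β x u → ψ u ≡ swapCol α β (θ′ u)
        ψ-on-K u u∈K with K⊆K′∪v u∈K
        ... | inj₁ (refl , joins) rewrite ≔-updates θ₂ v new-colour | dec-true JoinsV? joins = refl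
        ... | inj₂ (u≢v , ¬¬u∈K′) = trans (≔-minimal θ₂ new-colour u≢v)
          (decidable-stable (θ₂ u ≟ swapCol α β (θ′ u)) λ ne → ¬¬u∈K′ λ u∈K′ →
            ne (trans (on-K′ u u∈K′) (cong (swapCol α β) (sym (θ′≈θ u u≢v)))))

        ψ-off-K : ∀ u → ¬ KComp H θ′ α β x u → ψ u ≡ θ′ u
        ψ-off-K u u∉K with u ≟ v
        ... | yes refl rewrite ≔-updates θ₂ v new-colour | dec-false JoinsV? (v∉K⇒¬JoinsV u∉K) = refl
        ... | no u≢v = trans (≔-minimal θ₂ new-colour u≢v)
                             (trans (off-K′ u (u∉K ∘ K′⇒K)) (sym (θ′≈θ u u≢v)))

        swap : KempeSwap H θ′ ψ
        swap = α , β , x , subst (InPair α β) (sym (θ′≈θ x x≢v)) x-col , ψ-on-K , ψ-off-K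

        new-colour∈L : new-colour ∈ L v
        new-colour∈L = by-cases JoinsV?
          where
          by-cases : Dec JoinsV → new-colour ∈ L v
          by-cases (yes joins)  rewrite dec-true JoinsV? joins   = joins⇒swap∈L joins
          by-cases (no ¬joins) rewrite dec-false JoinsV? ¬joins = proj₁ θ′-col v

        ψ∈L : ∀ u → ψ u ∈ L u
        ψ∈L u with u ≟ v
        ... | yes refl = subst (_∈ L v) (sym (≔-updates θ₂ v new-colour)) new-colour∈L
        ... | no u≢v   = subst (_∈ L u) (sym (≔-minimal θ₂ new-colour u≢v)) (θ₂∈L u)

        lifted : Reachesᵥ θ′ θ₂
        lifted = ψ , (θ′-col , ψ-col , swap) ◅ ε , ψ-col , λ u → ≔-minimal θ₂ new-colour
          where
          ψ-col : IsLColoring H L ψ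
          ψ-col = ψ∈L , kempe-proper swap (proj₂ θ′-col)

      lifted-uninvolved : ¬ InPair α β (θ′ v) → Reachesᵥ θ′ θ₂
      lifted-uninvolved v∉pair = lifted (⊥-elim ∘ v∉pair ∘ proj₁) (⊥-elim ∘ v∉pair ∘ proj₁)

      module _ (v∈pair : InPair α β (θ′ v)) (no-spare : ¬ Spare θ′) where

        partner : Fin k
        partner = swapCol α β (θ′ v)

        palette : ∀ {c} → c ∈ L v → c ≡ θ′ v ⊎ c ≡ partner ⊎ ∃ λ w → adj H v w ≡ true × θ′ w ≡ c
        palette {c} c∈L with InPair? α β c
        ... | yes c∈pair = map₂ inj₁ (InPair-partner v∈pair c∈pair)
        ... | no c∉pair with any? (λ w → (adj H v w ≟ᵇ true) ×-dec (θ′ w ≟ c))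
        ...   | yes on-neighbour  = inj₂ (inj₂ on-neighbour)
        ...   | no ¬on-neighbour =
          ⊥-elim (no-spare (c , c∈L , c∉pair , λ w vw θ′w≡c → ¬on-neighbour (w , vw , θ′w≡c)))

        -- Recolouring w₁ to θ′ v would leave every colour of L v on a neighbour of v.
        partner-unique : ∀ w₁ → adj H v w₁ ≡ true → θ′ w₁ ≡ partner →
          ¬ (partner ∈ L v → ∃ λ w → w ≢ w₁ × adj H v w ≡ true × θ′ w ≡ partner)
        partner-unique w₁ vw₁ θ′w₁≡partner partner-twice =
          <-irrefl refl (<-≤-trans few-neighbours (∣L∣≤deg H L v (θ′ [ w₁ ≔ θ′ v ]) covered))
          where
          partner-elsewhere : partner ∈ L v → ∃ λ w → adj H v w ≡ true × (θ′ [ w₁ ≔ θ′ v ]) w ≡ partner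
          partner-elsewhere partner∈L with partner-twice partner∈L
          ... | w , w≢w₁ , vw , θ′w≡partner = w , vw , trans (≔-minimal θ′ (θ′ v) w≢w₁) θ′w≡partner
          covered : ∀ {c} → c ∈ L v → ∃ λ w → adj H v w ≡ true × (θ′ [ w₁ ≔ θ′ v ]) w ≡ c
          covered c∈L with palette c∈L
          ... | inj₁ refl        = w₁ , vw₁ , ≔-updates θ′ w₁ (θ′ v)
          ... | inj₂ (inj₁ refl) = partner-elsewhere c∈L
          ... | inj₂ (inj₂ (w , vw , refl)) with w ≟ w₁
          ...   | no w≢w₁ = w , vw , ≔-minimal θ′ (θ′ v) w≢w₁
          ...   | yes refl with w′ , vw′ , eq ← partner-elsewhere (subst (_∈ L v) θ′w₁≡partner c∈L) =
            w′ , vw′ , trans eq (sym θ′w₁≡partner)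

        neighbour-in-pair : ∀ {w} → adj H v w ≡ true → InPair α β (θ′ w) → θ′ w ≡ partner
        neighbour-in-pair {w} vw w∈pair with InPair-partner v∈pair w∈pair
        ... | inj₁ θ′w≡θ′v      = contradiction (sym θ′w≡θ′v) (proj₂ θ′-col v w vw)
        ... | inj₂ θ′w≡partner = θ′w≡partner

        moved-neighbour : ∀ {w} → adj H v w ≡ true → Moved w → θ′ w ≡ partner
        moved-neighbour {w} vw moved = neighbour-in-pair vw
          (subst (InPair α β) (sym (θ′≈θ w (≢-sym (adj⇒≢ H vw)))) (Moved⇒InPair moved))

        joins⇒partner∈L : JoinsV → partner ∈ L v
        joins⇒partner∈L (_ , w₁ , vw₁ , moved) with partner ∈? L v
        ... | yes partner∈L = partner∈L
        ... | no partner∉L  = ⊥-elim (partner-unique w₁ vw₁ (moved-neighbour vw₁ moved) (⊥-elim ∘ partner∉L))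

        joins⇒neighbours-moved : JoinsV → ∀ w → adj H v w ≡ true → InPair α β (θ′ w) → Moved w
        joins⇒neighbours-moved (_ , w₁ , vw₁ , moved₁) w vw w∈pair with w ≟ w₁
        ... | yes refl = moved₁
        ... | no w≢w₁  = ⊥-elim (partner-unique w₁ vw₁ (moved-neighbour vw₁ moved₁)
                                  λ _ → w , w≢w₁ , vw , neighbour-in-pair vw w∈pair)

        lifted-blocked : Reachesᵥ θ′ θ₂
        lifted-blocked = lifted joins⇒neighbours-moved joins⇒partner∈L

    lift-swap : ∀ θ′ → IsLColoring H L θ′ → θ′ ≈ᵥ θ → Reachesᵥ θ′ θ₂
    lift-swap θ′ θ′-col θ′≈θ with InPair? α β (θ′ v) | Spare? θ′
    ... | no v∉pair | _             = lifted-uninvolved θ′ θ′-col θ′≈θ v∉pair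
    ... | yes v∈pair | no no-spare = lifted-blocked θ′ θ′-col θ′≈θ v∈pair no-spare
    ... | yes _ | yes (c , c∈L , c∉pair , c-free) =
      let recolour-v = recolour-step θ′-col c∈L c-free
          χ , steps , χ-col , χ≈θ₂ =
            lifted-uninvolved (θ′ [ v ≔ c ]) (proj₁ (proj₂ recolour-v))
              (λ u u≢v → trans (≔-minimal θ′ c u≢v) (θ′≈θ u u≢v))
              (c∉pair ∘ subst (InPair α β) (≔-updates θ′ v c))
      in χ , recolour-v ◅ steps , χ-col , χ≈θ₂

  lift-step : ∀ {θ θ₂} → LSwapStep H′ L θ θ₂ → ∀ θ′ → IsLColoring H L θ′ → θ′ ≈ᵥ θ → Reachesᵥ θ′ θ₂
  lift-step {θ} {θ₂} (_ , θ₂-col , α , β , x , x-col , on-K′ , off-K′) θ′ θ′-col θ′≈θ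
    with α ≟ β | x ≟ v
  ... | yes refl | _ = θ′ , ε , θ′-col , λ u u≢v → trans (θ′≈θ u u≢v) (sym (unchanged u))
    where
    unchanged : ∀ u → θ₂ u ≡ θ u
    unchanged u = decidable-stable (θ₂ u ≟ θ u) λ θ₂u≢θu → ¬¬-excluded-middle λ
      { (yes u∈K′) → θ₂u≢θu (trans (on-K′ u u∈K′) (swapCol-diag α (θ u)))
      ; (no u∉K′)  → θ₂u≢θu (off-K′ u u∉K′) }
  ... | no _ | yes refl = θ′ , ε , θ′-col , λ u u≢v → trans (θ′≈θ u u≢v) (sym (off-K′ u (u≢v ∘ K′-is-v)))
    where
    K′-is-v : ∀ {u} → KComp H′ θ α β v u → u ≡ v
    K′-is-v (base _) = refl
    K′-is-v (step u∈K′ uw _) with refl ← K′-is-v u∈K′ = contradiction uw no-edge-at-v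
  ... | no α≢β | no x≢v =
    LiftSwap.lift-swap θ θ₂ (proj₁ θ₂-col) α β x x-col on-K′ off-K′ α≢β x≢v θ′ θ′-col θ′≈θ

  lift-steps : ∀ {θ θ₂} → Star (LSwapStep H′ L) θ θ₂ → ∀ θ′ → IsLColoring H L θ′ → θ′ ≈ᵥ θ → Reachesᵥ θ′ θ₂
  lift-steps ε θ′ θ′-col θ′≈θ = θ′ , ε , θ′-col , θ′≈θ
  lift-steps (s ◅ ss) θ′ θ′-col θ′≈θ =
    let χ₁ , steps₁ , χ₁-col , χ₁≈ = lift-step s θ′ θ′-col θ′≈θ
        χ₂ , steps₂ , χ₂-col , χ₂≈ = lift-steps ss χ₁ χ₁-col χ₁≈
    in χ₂ , steps₁ ◅◅ steps₂ , χ₂-col , χ₂≈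

  reattach : LSwappable H′ L → LSwappable H L
  reattach swappable φ ψ φ-col ψ-col =
    χ [ v ≔ ψ v ] , steps ◅◅ (recolour-v ◅ ε) , agrees
    where
    H′-run = swappable φ ψ (LColouring-⊆ H′⊆H φ-col) (LColouring-⊆ H′⊆H ψ-col)
    lifted-run = lift-steps (proj₁ (proj₂ H′-run)) φ φ-col λ _ _ → refl
    χ = proj₁ lifted-run
    steps = proj₁ (proj₂ lifted-run)
    χ≈ψ : χ ≈ᵥ ψ
    χ≈ψ u u≢v = trans (proj₂ (proj₂ (proj₂ lifted-run)) u u≢v) (proj₂ (proj₂ H′-run) u)
    recolour-v : LSwapStep H L χ (χ [ v ≔ ψ v ])
    recolour-v = recolour-step (proj₁ (proj₂ (proj₂ lifted-run))) (proj₁ ψ-col v)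
      λ u vu χu≡ψv → proj₂ ψ-col v u vu (sym (trans (sym (χ≈ψ u (≢-sym (adj⇒≢ H vu)))) χu≡ψv))
    agrees : ∀ u → (χ [ v ≔ ψ v ]) u ≡ ψ u
    agrees u with u ≟ v
    ... | yes refl = ≔-updates χ v (ψ v)
    ... | no u≢v   = trans (≔-minimal χ (ψ v) u≢v) (χ≈ψ u u≢v)

swappable-peel : ∀ {n k} (G : Graph n) (L : ListAssignment n k) {R R′ : Fin n → Bool} {v} →
  R′ v ≡ true → (∀ u → u ≢ v → R′ u ≡ R u) → deg (isolate G R) v < ∣ L v ∣ →
  LSwappable (isolate G R′) L → LSwappable (isolate G R) L
swappable-peel G L {R} {R′} {v} R′v R′≈R few-neighbours =
  Reattach.reattach (isolate G R) (isolate G R′) L v (isolated-adj G R′ R′v) same-off-v few-neighbours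
  where
  same-off-v : ∀ u w → u ≢ v → w ≢ v → adj (isolate G R′) u w ≡ adj (isolate G R) u w
  same-off-v u w u≢v w≢v rewrite R′≈R u u≢v | R′≈R w w≢v = refl

does≡false⇒¬ : ∀ {P : Set} (P? : Dec P) → does P? ≡ false → ¬ P
does≡false⇒¬ (no ¬p) _ = ¬p

module DegenerateOrdering {n k} (G : Graph n) (L : ListAssignment n k) (σ : Permutation′ n)
  (few-preceding : ∀ v → precedingNbrs G σ v < ∣ L v ∣) where

  pos : Fin n → ℕ
  pos u = toℕ (σ ⟨$⟩ʳ u)

  pos-injective : ∀ {u w} → pos u ≡ pos w → u ≡ w
  pos-injective = Injection.injective (↔⇒↣ σ) ∘ toℕ-injective

  From : ℕ → Fin n → Bool
  From j u = does (j ≤? pos u)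

  swappable-isolate-From : ∀ j → j ≤ n → LSwappable (isolate G (From j)) L
  swappable-isolate-From zero    _   = swappable-isolate-all G λ _ → refl
  swappable-isolate-From (suc j) j<n =
    swappable-peel G L From-j-v From-j≈From-1+j few-neighbours (swappable-isolate-From j (<⇒≤ j<n))
    where
    v : Fin n
    v = σ ⟨$⟩ˡ fromℕ< j<n
    pos-v : pos v ≡ j
    pos-v = trans (cong toℕ (inverseʳ σ)) (toℕ-fromℕ< j<n)
    From-j-v : From j v ≡ true
    From-j-v = dec-true (j ≤? pos v) (≤-reflexive (sym pos-v))
    From-j≈From-1+j : ∀ u → u ≢ v → From j u ≡ From (suc j) u
    From-j≈From-1+j u u≢v = by-cases (suc j ≤? pos u)
      where
      by-cases : Dec (suc j ≤ pos u) → From j u ≡ From (suc j) u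
      by-cases (yes j<pos-u) =
        trans (dec-true (j ≤? pos u) (<⇒≤ j<pos-u)) (sym (dec-true (suc j ≤? pos u) j<pos-u))
      by-cases (no j≮pos-u) = trans (dec-false (j ≤? pos u) j≰pos-u) (sym (dec-false (suc j ≤? pos u) j≮pos-u))
        where
        j≰pos-u : ¬ j ≤ pos u
        j≰pos-u j≤pos-u =
          j≮pos-u (≤∧≢⇒< j≤pos-u λ j≡pos-u → u≢v (pos-injective (trans (sym j≡pos-u) (sym pos-v))))
    preceding : ∀ u → adj (isolate G (From (suc j))) v u ≡ true →
                adj G v u ∧ ⌊ (σ ⟨$⟩ʳ u) <ᶠ? (σ ⟨$⟩ʳ v) ⌋ ≡ true
    preceding u vu′ with _ , u-before , vu ← isolate-adj G (From (suc j)) v u vu′ =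
      cong₂ _∧_ vu (trans (isYes≗does ((σ ⟨$⟩ʳ u) <ᶠ? (σ ⟨$⟩ʳ v))) (dec-true ((σ ⟨$⟩ʳ u) <ᶠ? (σ ⟨$⟩ʳ v)) pos-u<pos-v))
      where
      pos-u<pos-v : pos u < pos v
      pos-u<pos-v = ≤∧≢⇒< (subst (pos u ≤_) (sym pos-v) (≮⇒≥ (does≡false⇒¬ (suc j ≤? pos u) u-before)))
                          (≢-sym (adj⇒≢ G vu) ∘ pos-injective)
    few-neighbours : deg (isolate G (From (suc j))) v < ∣ L v ∣
    few-neighbours = ≤-<-trans (countB-mono preceding (allFin n)) (few-preceding v)

  swappable : LSwappable G L
  swappable = swappable-isolate-none G (swappable-cong none-from-n (swappable-isolate-From n ≤-refl))
    where
    none-from-n : ∀ u w → adj (isolate G (From n)) u w ≡ adj (isolate G (const false)) u w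
    none-from-n u w rewrite dec-false (n ≤? pos u) (<⇒≱ (toℕ<n (σ ⟨$⟩ʳ u)))
                          | dec-false (n ≤? pos w) (<⇒≱ (toℕ<n (σ ⟨$⟩ʳ w))) = refl

walk-leaves : ∀ {n} (G : Graph n) (R : Fin n → Bool) {r u} → Reach G r u → R r ≡ true → R u ≡ false →
              ∃₂ λ a b → adj G a b ≡ true × R a ≡ true × R b ≡ false
walk-leaves G R here Rr Ru = contradiction (trans (sym Rr) Ru) λ ()
walk-leaves G R (step {v} walk vu) Rr Ru with R v in Rv
... | true  = v , _ , vu , Rv , Ru
... | false = walk-leaves G R walk Rr Rv

_∪｛_｝ : ∀ {n} → (Fin n → Bool) → Fin n → Fin n → Bool
(R ∪｛ b ｝) u = does (u ≟ b) ∨ R u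

module DegreeBound {n k} (G : Graph n) (L : ListAssignment n k) (connected : Connected G)
  (deg≤∣L∣ : ∀ v → deg G v ≤ ∣ L v ∣) (w : Fin n) where

  outside-count : (Fin n → Bool) → ℕ
  outside-count R = countB (not ∘ R) (allFin n)

  -- Connectivity supplies a vertex b outside R with an isolated neighbour, hence with
  -- fewer than deg G b ≤ ∣ L b ∣ neighbours in isolate G R.
  swappable-isolate-containing : ∀ m R → outside-count R < m → R w ≡ true → LSwappable (isolate G R) L
  swappable-isolate-containing zero    R ()          Rw
  swappable-isolate-containing (suc m) R outside<1+m Rw with any? (λ u → R u ≟ᵇ false)
  ... | no none-outside = swappable-isolate-all G λ u → ¬-not (none-outside ∘ (u ,_))
  ... | yes (u₀ , Ru₀) with a , b , ab , Ra , Rb ← walk-leaves G R (connected w u₀) Rw Ru₀ =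
    swappable-peel G L b-added (λ u u≢b → cong (_∨ R u) (dec-false (u ≟ b) u≢b)) few-neighbours
      (swappable-isolate-containing m (R ∪｛ b ｝)
        (<-≤-trans (countB-< (shrinks) (∈-allFin b) (cong not Rb) (cong not b-added)) (s≤s⁻¹ outside<1+m))
        (trans (cong (does (w ≟ b) ∨_) Rw) (∨-zeroʳ _)))
    where
    b-added : (R ∪｛ b ｝) b ≡ true
    b-added = cong (_∨ R b) (dec-true (b ≟ b) refl)
    shrinks : ∀ u → not ((R ∪｛ b ｝) u) ≡ true → not (R u) ≡ true
    shrinks u u∉R∪b with u ≟ b
    ... | no _ = u∉R∪b
    few-neighbours : deg (isolate G R) b < ∣ L b ∣
    few-neighbours = <-≤-trans
      (countB-< (λ u → proj₂ ∘ proj₂ ∘ isolate-adj G R b u) (∈-allFin a) (trans (adj-sym G b a) ab)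
                (trans (adj-sym (isolate G R) b a) (isolated-adj G R Ra b)))
      (deg≤∣L∣ b)

  swappable : deg G w < ∣ L w ∣ → LSwappable G L
  swappable few-neighbours = swappable-isolate-none G
    (swappable-peel G L w-isolated (λ u u≢w → cong (_∨ false) (dec-false (u ≟ w) u≢w)) few-neighbours
      (swappable-isolate-containing _ (const false ∪｛ w ｝) (n<1+n _) w-isolated))
    where
    w-isolated : (const false ∪｛ w ｝) w ≡ true
    w-isolated = cong (_∨ false) (dec-true (w ≟ w) refl)

corollary7 : ∀ (n k : ℕ) (G : Graph n) (L : ListAssignment n k) → Connected G →
    ((Σ (Permutation′ n) λ σ → ∀ v → precedingNbrs G σ v < ∣ L v ∣) → LSwappable G L)
    × (((∀ v → deg G v ≤ ∣ L v ∣) × (Σ (Fin n) λ w → deg G w < ∣ L w ∣)) → LSwappable G L)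
corollary7 n k G L connected =
  (λ (σ , few-preceding) → DegenerateOrdering.swappable G L σ few-preceding) ,
  (λ (deg≤∣L∣ , w , few-neighbours) → DegreeBound.swappable G L connected deg≤∣L∣ w few-neighbours)
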